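{- Let $k,r\geq 1$, let $1\leq a\leq b\leq k$, let $I_d\subseteq\{1,2,\dots,r\}$ be a set of $d$ colours, and let $n\geq k$. Then $$\Big|S_n^{(r)}\Big(\bigcup_{m=a}^b T_{k,r}^m(I_d)\Big)\Big|=(k-1)!\,r^{k-1}\prod_{j=k}^n \big(d(k+a-b-1)+j(r-d)\big).$$
   Context: $S_n^{(r)}$ denotes the set of coloured permutations of $\{1,\dots,n\}$ with colours $\{1,\dots,r\}$: sequences $\psi=(\alpha_1^{(v_1)},\dots,\alpha_n^{(v_n)})$ where $(\alpha_1,\dots,\alpha_n)$ is a permutation of $\{1,\dots,n\}$ and each $v_i\in\{1,\dots,r\}$ is the colour of the symbol $\alpha_i$. For $\phi=(\tau_1^{(s_1)},\dots,\tau_k^{(s_k)})\in S_k^{(r)}$, $\psi$ contains $\phi$ if there are indices $1\leq i_1<\dots<i_k\leq n$ such that $(\alpha_{i_1},\dots,\alpha_{i_k})$ is order-isomorphic to $(\tau_1,\dots,\tau_k)$ and $v_{i_j}=s_j$ for all $j$; otherwise $\psi$ avoids $\phi$. For a set $T$ of coloured patterns, $S_n^{(r)}(T)$ is the set of $\psi\in S_n^{(r)}$ avoiding every $\phi\in T$. For $I_d\subseteq\{1,\dots,r\}$ with $|I_d|=d$ and $1\le m\le k$, $T_{k,r}^m(I_d)$ is the set of all $\phi\in S_k^{(r)}$ whose first entry is the symbol $m$ with colour in $I_d$. -}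

module Defs where

open import Data.Nat using (ℕ; zero; suc; _+_; _*_; _≤_; _<_; _∸_)
open import Data.Fin as F using (Fin; toℕ)
open import Data.Fin.Subset using (Subset; _∈_)
open import Data.Vec using (Vec; lookup)
open import Data.List using (List; length)
open import Data.List.Relation.Unary.Unique.Propositional using (Unique)
import Data.List.Membership.Propositional as LM
open import Data.Product using (Σ; ∃; _×_; _,_; proj₁; proj₂)
open import Relation.Binary.PropositionalEquality using (_≡_)
open import Relation.Nullary using (¬_)
open import Function.Bundles using (_⇔_)

-- A (candidate) coloured word of length n over symbols Fin n and colours Fin r.
-- Symbol i : Fin n stands for the number toℕ i + 1, colour c : Fin r for toℕ c + 1.
Word : ℕ → ℕ → Set
Word n r = Vec (Fin n × Fin r) n

symb : ∀ {n r} → Word n r → Fin n → Fin n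
symb w i = proj₁ (lookup w i)

col : ∀ {n r} → Word n r → Fin n → Fin r
col w i = proj₂ (lookup w i)

IsPerm : ∀ {n r} → Word n r → Set
IsPerm {n} w = ∀ (i j : Fin n) → symb w i ≡ symb w j → i ≡ j

IsColPerm : ∀ {n r} → Word n r → Set
IsColPerm = IsPerm

Contains : ∀ {n k r} → Word n r → Word k r → Set
Contains {n} {k} ψ φ =
  Σ (Fin k → Fin n) λ f →
    (∀ (j j' : Fin k) → j F.< j' → f j F.< f j')
    × (∀ (j j' : Fin k) → (symb ψ (f j) F.< symb ψ (f j')) ⇔ (symb φ j F.< symb φ j'))
    × (∀ (j : Fin k) → col ψ (f j) ≡ col φ j)

InT : ∀ {k r} → (m : ℕ) → Subset r → Word k r → Set
InT {k} m I φ = IsColPerm φ ×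
  (∀ (j : Fin k) → toℕ j ≡ 0 → (toℕ (symb φ j) + 1 ≡ m) × (col φ j ∈ I))

InUnionT : ∀ {k r} → ℕ → ℕ → Subset r → Word k r → Set
InUnionT a b I φ = Σ ℕ λ m → a ≤ m × m ≤ b × InT m I φ

InAvoidSet : ∀ {n r} → (k a b : ℕ) → Subset r → Word n r → Set
InAvoidSet {r = r} k a b I ψ =
  IsColPerm ψ × (∀ (φ : Word k r) → InUnionT a b I φ → ¬ Contains ψ φ)

HasCard : ∀ {A : Set} → (A → Set) → ℕ → Set
HasCard {A} P N = Σ (List A) λ L →
  Unique L × (∀ (x : A) → (x LM.∈ L) ⇔ P x) × length L ≡ N

prodLen : ℕ → ℕ → (ℕ → ℕ) → ℕ
prodLen k zero f = 1
prodLen k (suc c) f = f k * prodLen (suc k) c f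

-- ∏_{j=k}^{n} f j  (empty product = 1 if n < k)
prodFromTo : ℕ → ℕ → (ℕ → ℕ) → ℕ
prodFromTo k n f = prodLen k (suc n ∸ k) f

-- A coloured permutation of length n + 1 is its first entry x^(c) followed by (the standardisation
-- of) a coloured permutation w of length n, and it avoids the patterns iff w does and the first
-- entry starts no occurrence. A pattern with first symbol m ∈ [a, b] can start at x only if x has
-- m − 1 smaller and k − m larger values after it; conversely, if c ∈ I and some m fits, the k
-- entries with values in the window [x − m + 1, x − m + k] form an occurrence. So for c ∈ I the
-- forbidden values are a ≤ x ≤ n + 1 + b − k (none while n + 1 < k), leaving k + a − b − 1 values
-- once n + 1 ≥ k. Each step therefore multiplies the count by (n + 1) r while n + 1 < k and by
-- d (k + a − b − 1) + (n + 1)(r − d) afterwards.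

module Submission where

open import Defs
open import Data.Nat using (ℕ; _+_; _*_; _∸_; _^_; _≤_; _!)
open import Data.Fin.Subset using (Subset; ∣_∣)

open import Data.Nat using (zero; suc; _<_; _≤?_; _<?_; _⊔_; z≤n; s≤s; s≤s⁻¹; z<s; s<s; s<s⁻¹)
open import Data.Nat.Properties
open import Data.Nat.Solver using (module +-*-Solver)
open +-*-Solver using (solve; _:*_; _:=_)
open import Data.Fin as F using (Fin; toℕ; fromℕ<; inject≤; punchIn; punchOut; opposite)
import Data.Fin.Properties as F
open import Data.Fin.Subset using (_∈_; _∉_; ∁; inside; outside)
open import Data.Fin.Subset.Properties
  using (_∈?_; x∈∁p⇒x∉p; x∉p⇒x∈∁p; ∣∁p∣≡n∸∣p∣; ∣p∣≤n)
open import Data.List as List using (List; []; _∷_; _++_; cartesianProduct; allFin; length)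
open import Data.List.Properties using (length-++; length-map; length-tabulate)
open import Data.List.Membership.Propositional using () renaming (_∈_ to _∈ₗ_)
open import Data.List.Membership.Propositional.Properties
  using (∈-map⁺; ∈-map⁻; ∈-++⁺ˡ; ∈-++⁺ʳ; ∈-++⁻; ∈-cartesianProduct⁺; ∈-cartesianProduct⁻;
         ∈-allFin)
import Data.List.Relation.Unary.Any as Any
import Data.List.Relation.Unary.All as All
import Data.List.Relation.Unary.AllPairs as AllPairs
import Data.List.Relation.Unary.Unique.Propositional.Properties as Unique
open import Data.Vec as Vec using ([]; _∷_; lookup; tabulate; here; there)
open import Data.Vec.Properties
  using (lookup-map; ∷-injective; tabulate-∘; tabulate-cong; tabulate∘lookup; lookup∘tabulate)
open import Data.Product as Product using (∃; ∃₂; _×_; _,_; proj₁; proj₂; uncurry)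
open import Data.Sum as Sum using (_⊎_; inj₁; inj₂; [_,_])
open import Data.Unit using (⊤; tt)
open import Data.Empty using (⊥)
open import Function using (_∘_; id)
open import Function.Bundles using (_⇔_; mk⇔; Equivalence)
open import Function.Definitions using (Injective)
open import Function.Properties.Equivalence using () renaming (trans to ⇔-trans; sym to ⇔-sym)
open import Relation.Nullary using (¬_; yes; no; contradiction)
open import Relation.Nullary.Decidable using (_×-dec_)
open import Relation.Unary using (Pred; Decidable)
open import Relation.Binary using (tri<; tri≈; tri>)
open import Level using (0ℓ)
open import Relation.Binary.PropositionalEquality hiding ([_])

open Equivalence using (to; from)

-- Cardinalities of finite predicates

module _ {A : Set} where

  HasCard-⇔ : ∀ {P Q : A → Set} {N} → (∀ x → P x ⇔ Q x) → HasCard P N → HasCard Q N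
  HasCard-⇔ P⇔Q (xs , xs! , xs⇔P , len) = xs , xs! , (λ x → ⇔-trans (xs⇔P x) (P⇔Q x)) , len

  HasCard-≡ : ∀ (x : A) → HasCard (_≡ x) 1
  HasCard-≡ x =
    x ∷ [] , All.[] AllPairs.∷ AllPairs.[] ,
    (λ y → mk⇔ (λ { (Any.here y≡x) → y≡x ; (Any.there ()) }) Any.here) , refl

  HasCard-⊎ : ∀ {P Q : A → Set} {p q} → (∀ x → P x → Q x → ⊥) →
              HasCard P p → HasCard Q q → HasCard (λ x → P x ⊎ Q x) (p + q)
  HasCard-⊎ P∩Q=∅ (xs , xs! , xs⇔P , refl) (ys , ys! , ys⇔Q , refl) =
    xs ++ ys ,
    Unique.++⁺ xs! ys! (λ (x∈xs , x∈ys) → P∩Q=∅ _ (to (xs⇔P _) x∈xs) (to (ys⇔Q _) x∈ys)) ,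
    (λ x → mk⇔ (Sum.map (to (xs⇔P x)) (to (ys⇔Q x)) ∘ ∈-++⁻ xs)
               [ ∈-++⁺ˡ ∘ from (xs⇔P x) , ∈-++⁺ʳ xs ∘ from (ys⇔Q x) ]) ,
    length-++ xs

HasCard-image : ∀ {A B : Set} {P : A → Set} {p} (f : A → B) → Injective _≡_ _≡_ f →
                HasCard P p → HasCard (λ y → ∃ λ x → P x × f x ≡ y) p
HasCard-image {P = P} f f-inj (xs , xs! , xs⇔P , refl) =
  List.map f xs , Unique.map⁺ f-inj xs! , mem , length-map f xs
  where
  mem : ∀ y → (y ∈ₗ List.map f xs) ⇔ (∃ λ x → P x × f x ≡ y)
  mem y = mk⇔ (λ y∈ → let x , x∈xs , y≡fx = ∈-map⁻ f y∈ in x , to (xs⇔P x) x∈xs , sym y≡fx)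
              (λ { (x , Px , refl) → ∈-map⁺ f (from (xs⇔P x) Px) })

length-cartesianProduct : ∀ {A B : Set} (xs : List A) (ys : List B) →
                          length (cartesianProduct xs ys) ≡ length xs * length ys
length-cartesianProduct []       ys = refl
length-cartesianProduct (x ∷ xs) ys = begin
  length (List.map (x ,_) ys ++ cartesianProduct xs ys)     ≡⟨ length-++ (List.map (x ,_) ys) ⟩
  length (List.map (x ,_) ys) + length (cartesianProduct xs ys)
    ≡⟨ cong₂ _+_ (length-map (x ,_) ys) (length-cartesianProduct xs ys) ⟩
  length ys + length xs * length ys                          ∎
  where open ≡-Reasoning

HasCard-× : ∀ {A B : Set} {P : A → Set} {Q : B → Set} {p q} → HasCard P p → HasCard Q q →
            HasCard (λ xy → P (proj₁ xy) × Q (proj₂ xy)) (p * q)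
HasCard-× {P = P} {Q} (xs , xs! , xs⇔P , refl) (ys , ys! , ys⇔Q , refl) =
  cartesianProduct xs ys , Unique.cartesianProduct⁺ xs! ys! , mem , length-cartesianProduct xs ys
  where
  mem : ∀ xy → (xy ∈ₗ cartesianProduct xs ys) ⇔ (P (proj₁ xy) × Q (proj₂ xy))
  mem (x , y) = mk⇔ (Product.map (to (xs⇔P x)) (to (ys⇔Q y)) ∘ ∈-cartesianProduct⁻ xs ys)
                    (λ (Px , Qy) → ∈-cartesianProduct⁺ (from (xs⇔P x) Px) (from (ys⇔Q y) Qy))

HasCard-Fin : ∀ n → HasCard {Fin n} (λ _ → ⊤) n
HasCard-Fin n = allFin n , Unique.allFin⁺ n , (λ i → mk⇔ _ (λ _ → ∈-allFin i)) , length-tabulate id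

HasCard-∈ : ∀ {n} (p : Subset n) → HasCard (_∈ p) ∣ p ∣
HasCard-∈ []            = [] , AllPairs.[] , (λ ()) , refl
HasCard-∈ (outside ∷ p) = HasCard-⇔ mem (HasCard-image F.suc F.suc-injective (HasCard-∈ p))
  where
  mem : ∀ x → (∃ λ y → y ∈ p × F.suc y ≡ x) ⇔ (x ∈ outside ∷ p)
  mem F.zero    = mk⇔ (λ { (_ , _ , ()) }) (λ ())
  mem (F.suc x) = mk⇔ (λ { (_ , y∈p , refl) → there y∈p }) (λ { (there x∈p) → x , x∈p , refl })
HasCard-∈ (inside ∷ p)  =
  HasCard-⇔ mem (HasCard-⊎ (λ { _ refl (_ , _ , ()) }) (HasCard-≡ F.zero)
                            (HasCard-image F.suc F.suc-injective (HasCard-∈ p)))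
  where
  mem : ∀ x → (x ≡ F.zero ⊎ ∃ λ y → y ∈ p × F.suc y ≡ x) ⇔ (x ∈ inside ∷ p)
  mem F.zero    = mk⇔ (λ _ → here) (λ _ → inj₁ refl)
  mem (F.suc x) = mk⇔ (λ { (inj₂ (_ , y∈p , refl)) → there y∈p })
                      (λ { (there x∈p) → inj₂ (x , x∈p , refl) })

HasCard-∉ : ∀ {n} (p : Subset n) → HasCard (_∉ p) (n ∸ ∣ p ∣)
HasCard-∉ p = HasCard-⇔ (λ x → mk⇔ x∈∁p⇒x∉p x∉p⇒x∈∁p)
                        (subst (HasCard (_∈ ∁ p)) (∣∁p∣≡n∸∣p∣ p) (HasCard-∈ (∁ p)))

HasCard-toℕ< : ∀ {n m} → m ≤ n → HasCard {Fin n} (λ i → toℕ i < m) m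
HasCard-toℕ< {n} {m} m≤n = HasCard-⇔ mem (HasCard-image (λ i → inject≤ i m≤n)
                                             (F.inject≤-injective _ _ _ _) (HasCard-Fin m))
  where
  mem : ∀ i → (∃ λ j → ⊤ × inject≤ j m≤n ≡ i) ⇔ (toℕ i < m)
  mem i = mk⇔ (λ { (j , _ , refl) → subst (_< m) (sym (F.toℕ-inject≤ j m≤n)) (F.toℕ<n j) })
              (λ i<m → fromℕ< i<m , tt ,
                       F.toℕ-injective (trans (F.toℕ-inject≤ _ m≤n) (F.toℕ-fromℕ< i<m)))

HasCard-involution : ∀ {A : Set} {P : A → Set} {p} (f : A → A) → (∀ x → f (f x) ≡ x) →
                     HasCard P p → HasCard (P ∘ f) p
HasCard-involution {P = P} f f∘f≡id = HasCard-⇔ mem ∘ HasCard-image f f-inj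
  where
  f-inj : Injective _≡_ _≡_ f
  f-inj {x} {y} fx≡fy = trans (sym (f∘f≡id x)) (trans (cong f fx≡fy) (f∘f≡id y))
  mem : ∀ y → (∃ λ x → P x × f x ≡ y) ⇔ P (f y)
  mem y = mk⇔ (λ { (x , Px , refl) → subst P (sym (f∘f≡id x)) Px })
              (λ Pfy → f y , Pfy , f∘f≡id y)

toℕ-opposite<⇔ : ∀ {n} m (i : Fin n) → (toℕ (opposite i) < n ∸ suc m) ⇔ (m < toℕ i)
toℕ-opposite<⇔ {n} m i rewrite F.opposite-prop i = mk⇔
  (λ lt → ≰⇒> (λ i≤m → <⇒≱ lt (∸-monoʳ-≤ n (s≤s i≤m))))
  (λ m<i → ∸-monoʳ-< (s<s m<i) (F.toℕ<n i))

HasCard-<toℕ : ∀ {n} m → HasCard {Fin n} (λ i → m < toℕ i) (n ∸ suc m)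
HasCard-<toℕ {n} m = HasCard-⇔ (toℕ-opposite<⇔ m)
  (HasCard-involution opposite F.opposite-involutive (HasCard-toℕ< (m∸n≤m n (suc m))))

-- Injective and strictly increasing maps between finite ordinals

injective⇒surjective : ∀ {n} {f : Fin n → Fin n} → Injective _≡_ _≡_ f → ∀ y → ∃ λ x → f x ≡ y
injective⇒surjective {suc n} {f} f-inj y with F.any? (λ x → f x F.≟ y)
... | yes f⁻¹y = f⁻¹y
... | no  ∄x   = contradiction (F.injective⇒≤ g-inj) 1+n≰n
  where
  g : Fin (suc n) → Fin n
  g x = punchOut {i = y} (λ y≡fx → ∄x (x , sym y≡fx))
  g-inj : Injective _≡_ _≡_ g
  g-inj = f-inj ∘ F.punchOut-injective {i = y} _ _

injective⇒≤∸ : ∀ {m lo hi} (f : Fin m → ℕ) → Injective _≡_ _≡_ f →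
               (∀ x → lo ≤ f x) → (∀ x → f x < hi) → m ≤ hi ∸ lo
injective⇒≤∸ {m} {lo} {hi} f f-inj lo≤f f<hi = F.injective⇒≤ g-inj
  where
  g : Fin m → Fin (hi ∸ lo)
  g x = fromℕ< (∸-monoˡ-< (f<hi x) (lo≤f x))
  g-inj : Injective _≡_ _≡_ g
  g-inj gx≡gy = f-inj (∸-cancelʳ-≡ (lo≤f _) (lo≤f _)
    (trans (sym (F.toℕ-fromℕ< _)) (trans (cong toℕ gx≡gy) (F.toℕ-fromℕ< _))))

StrictlyIncreasing : ∀ {m n} → (Fin m → Fin n) → Set
StrictlyIncreasing {m} f = ∀ (i j : Fin m) → i F.< j → f i F.< f j

module _ {m n} {f : Fin m → Fin n} (f-inc : StrictlyIncreasing f) where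

  increasing⇒injective : Injective _≡_ _≡_ f
  increasing⇒injective {i} {j} fi≡fj with F.<-cmp i j
  ... | tri< i<j _ _ = contradiction fi≡fj (F.<⇒≢ (f-inc i j i<j))
  ... | tri≈ _ i≡j _ = i≡j
  ... | tri> _ _ j<i = contradiction (sym fi≡fj) (F.<⇒≢ (f-inc j i j<i))

  increasing⇒toℕ≤ : ∀ i → toℕ i ≤ toℕ (f i)
  increasing⇒toℕ≤ i = injective⇒≤∸ below below-inj (λ _ → z≤n) below<fi
    where
    i≤m : toℕ i ≤ m
    i≤m = <⇒≤ (F.toℕ<n i)
    below : Fin (toℕ i) → ℕ
    below x = toℕ (f (inject≤ x i≤m))
    below-inj : Injective _≡_ _≡_ below
    below-inj = F.inject≤-injective _ _ _ _ ∘ increasing⇒injective ∘ F.toℕ-injective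
    below<fi : ∀ x → below x < toℕ (f i)
    below<fi x = f-inc _ i (subst (_< toℕ i) (sym (F.toℕ-inject≤ x i≤m)) (F.toℕ<n x))

  increasing⇒room-above : ∀ i → m ∸ suc (toℕ i) ≤ n ∸ suc (toℕ (f i))
  increasing⇒room-above i = injective⇒≤∸ above above-inj fi<above (λ x → F.toℕ<n (f (index x)))
    where
    bound : ∀ (x : Fin (m ∸ suc (toℕ i))) → suc (toℕ i) + toℕ x < m
    bound x = <-≤-trans (+-monoʳ-< (suc (toℕ i)) (F.toℕ<n x)) (≤-reflexive (m+[n∸m]≡n (F.toℕ<n i)))
    index : Fin (m ∸ suc (toℕ i)) → Fin m
    index x = fromℕ< (bound x)
    above : Fin (m ∸ suc (toℕ i)) → ℕ
    above x = toℕ (f (index x))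
    above-inj : Injective _≡_ _≡_ above
    above-inj {x} {y} = F.toℕ-injective ∘ +-cancelˡ-≡ (suc (toℕ i)) _ _
      ∘ (λ eq → trans (sym (F.toℕ-fromℕ< (bound x))) (trans (cong toℕ eq) (F.toℕ-fromℕ< (bound y))))
      ∘ increasing⇒injective ∘ F.toℕ-injective
    fi<above : ∀ x → suc (toℕ (f i)) ≤ above x
    fi<above x = f-inc i (index x)
      (subst (toℕ i <_) (sym (F.toℕ-fromℕ< (bound x))) (s≤s (m≤m+n (toℕ i) (toℕ x))))

increasing⇒zero-first : ∀ {m n} {f : Fin (suc m) → Fin (suc n)} → StrictlyIncreasing f →
                        ∀ j → f j ≡ F.zero → f F.zero ≡ F.zero
increasing⇒zero-first f-inc F.zero    f0≡0 = f0≡0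
increasing⇒zero-first {f = f} f-inc (F.suc j) fj≡0 =
  contradiction (subst (f F.zero F.<_) fj≡0 (f-inc F.zero (F.suc j) z<s)) λ ()

record IncreasingEnumeration {n} (P : Pred (Fin n) 0ℓ) : Set where
  field
    size       : ℕ
    at         : Fin size → Fin n
    increasing : StrictlyIncreasing at
    sound      : ∀ j → P (at j)
    complete   : ∀ i → P i → ∃ λ j → at j ≡ i

enumerate : ∀ {n} {P : Pred (Fin n) 0ℓ} → Decidable P → IncreasingEnumeration P
enumerate {zero}      P? = record { size = 0 ; at = λ () ; increasing = λ () ; sound = λ () ; complete = λ () }
enumerate {suc n} {P} P? with P? F.zero
... | yes P0 = record
  { size       = suc size
  ; at         = λ { F.zero → F.zero ; (F.suc j) → F.suc (at j) }
  ; increasing = λ { F.zero (F.suc j) _ → z<s ; (F.suc i) (F.suc j) (s<s i<j) → s<s (increasing i j i<j) }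
  ; sound      = λ { F.zero → P0 ; (F.suc j) → sound j }
  ; complete   = λ { F.zero _ → F.zero , refl
                   ; (F.suc i) Pi → Product.map F.suc (cong F.suc) (complete i Pi) }
  }
  where open IncreasingEnumeration (enumerate (P? ∘ F.suc))
... | no ¬P0 = record
  { size       = size
  ; at         = F.suc ∘ at
  ; increasing = λ i j i<j → s<s (increasing i j i<j)
  ; sound      = sound
  ; complete   = λ { F.zero P0 → contradiction P0 ¬P0
                   ; (F.suc i) Pi → Product.map₂ (cong F.suc) (complete i Pi) }
  }
  where open IncreasingEnumeration (enumerate (P? ∘ F.suc))

-- Occurrences of patterns and prepending a first entry

Occurrence : ∀ {n k r} → Word n r → Word k r → (Fin k → Fin n) → Set
Occurrence {k = k} ψ φ f =
  StrictlyIncreasing f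
  × (∀ (j j' : Fin k) → (symb ψ (f j) F.< symb ψ (f j')) ⇔ (symb φ j F.< symb φ j'))
  × (∀ (j : Fin k) → col ψ (f j) ≡ col φ j)

occurrence-cong : ∀ {n k r} {ψ : Word n r} {φ : Word k r} {f g : Fin k → Fin n} →
                  (∀ j → f j ≡ g j) → Occurrence ψ φ f → Occurrence ψ φ g
occurrence-cong {ψ = ψ} {φ} f≗g (f-inc , order , colour) =
  (λ i j i<j → subst₂ F._<_ (f≗g i) (f≗g j) (f-inc i j i<j)) ,
  (λ j j' → subst (λ x → (x F.< _) ⇔ _) (cong (symb ψ) (f≗g j))
              (subst (λ x → (_ F.< x) ⇔ _) (cong (symb ψ) (f≗g j')) (order j j'))) ,
  (λ j → trans (cong (col ψ) (sym (f≗g j))) (colour j))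

occurrence⇒valueMap : ∀ {n k r} {ψ : Word n r} {φ : Word k r} {f} → IsPerm φ → Occurrence ψ φ f →
                      ∃ λ (g : Fin k → Fin n) →
                        StrictlyIncreasing g × (∀ j → g (symb φ j) ≡ symb ψ (f j))
occurrence⇒valueMap {n} {k} {ψ = ψ} {φ} {f} φ-perm (_ , order , _) = g , g-inc , g∘symb
  where
  preimage : ∀ y → ∃ λ j → symb φ j ≡ y
  preimage = injective⇒surjective (φ-perm _ _)
  g : Fin k → Fin n
  g y = symb ψ (f (proj₁ (preimage y)))
  g-inc : StrictlyIncreasing g
  g-inc y y' y<y' = from (order _ _)
    (subst₂ F._<_ (sym (proj₂ (preimage y))) (sym (proj₂ (preimage y'))) y<y')
  g∘symb : ∀ j → g (symb φ j) ≡ symb ψ (f j)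
  g∘symb j = cong (symb ψ ∘ f) (φ-perm _ _ (proj₂ (preimage (symb φ j))))

punchIn-<⇔ : ∀ {n} (v : Fin (suc n)) {x y} → (punchIn v x F.< punchIn v y) ⇔ (x F.< y)
punchIn-<⇔ v {x} {y} = mk⇔
  (λ lt → ≰⇒> (λ y≤x → <⇒≱ lt (F.punchIn-mono-≤ v y x y≤x)))
  (λ lt → ≰⇒> (λ py≤px → <⇒≱ lt (F.punchIn-cancel-≤ v y x py≤px)))

map-injective : ∀ {A B : Set} {m} {f : A → B} → Injective _≡_ _≡_ f →
                Injective _≡_ _≡_ (Vec.map {n = m} f)
map-injective f-inj {[]}     {[]}     _  = refl
map-injective f-inj {x ∷ xs} {y ∷ ys} eq =
  let fx≡fy , fxs≡fys = ∷-injective eq in cong₂ _∷_ (f-inj fx≡fy) (map-injective f-inj fxs≡fys)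

prepend : ∀ {n r} → Fin (suc n) × Fin r → Word n r → Word (suc n) r
prepend (v , c) w = (v , c) ∷ Vec.map (Product.map₁ (punchIn v)) w

module _ {n r} {v : Fin (suc n)} {c : Fin r} {w : Word n r} where

  private
    ψ : Word (suc n) r
    ψ = prepend (v , c) w

  symb-prepend : ∀ i → symb ψ (F.suc i) ≡ punchIn v (symb w i)
  symb-prepend i = cong proj₁ (lookup-map i _ w)

  col-prepend : ∀ i → col ψ (F.suc i) ≡ col w i
  col-prepend i = cong proj₂ (lookup-map i _ w)

  symb-prepend-<⇔ : ∀ i j → (symb ψ (F.suc i) F.< symb ψ (F.suc j)) ⇔ (symb w i F.< symb w j)
  symb-prepend-<⇔ i j rewrite symb-prepend i | symb-prepend j = punchIn-<⇔ v

  isPerm-prepend⇔ : IsPerm ψ ⇔ IsPerm w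
  isPerm-prepend⇔ = mk⇔
    (λ ψ-perm i j eq → F.suc-injective (ψ-perm (F.suc i) (F.suc j)
      (trans (symb-prepend i) (trans (cong (punchIn v) eq) (sym (symb-prepend j))))))
    (λ w-perm → λ
      { F.zero F.zero _ → refl
      ; F.zero (F.suc j) eq → contradiction (trans (sym (symb-prepend j)) (sym eq)) (F.punchInᵢ≢i v _)
      ; (F.suc i) F.zero eq → contradiction (trans (sym (symb-prepend i)) eq) (F.punchInᵢ≢i v _)
      ; (F.suc i) (F.suc j) eq → cong F.suc (w-perm i j (F.punchIn-injective v _ _
          (trans (sym (symb-prepend i)) (trans eq (symb-prepend j)))))
      })

  occurrence-prepend⇔ : ∀ {k} {φ : Word k r} {f} → Occurrence ψ φ (F.suc ∘ f) ⇔ Occurrence w φ f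
  occurrence-prepend⇔ = mk⇔
    (λ (f-inc , order , colour) →
      (λ i j i<j → s<s⁻¹ (f-inc i j i<j)) ,
      (λ j j' → ⇔-trans (⇔-sym (symb-prepend-<⇔ _ _)) (order j j')) ,
      (λ j → trans (sym (col-prepend _)) (colour j)))
    (λ (f-inc , order , colour) →
      (λ i j i<j → s<s (f-inc i j i<j)) ,
      (λ j j' → ⇔-trans (symb-prepend-<⇔ _ _) (order j j')) ,
      (λ j → trans (col-prepend _) (colour j)))

  contains-prepend : ∀ {k} {φ : Word k r} → Contains w φ → Contains ψ φ
  contains-prepend {φ = φ} (f , occ) = F.suc ∘ f , from (occurrence-prepend⇔ {φ = φ}) occ

  contains-prepend⁻ : ∀ {k} {φ : Word (suc k) r} ((f , _) : Contains ψ φ) → f F.zero ≢ F.zero →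
                      Contains w φ
  contains-prepend⁻ {k} {φ} (f , occ) f0≢0 =
    f′ , to (occurrence-prepend⇔ {φ = φ}) (occurrence-cong {ψ = ψ} {φ} (sym ∘ suc∘f′) occ)
    where
    fj≢0 : ∀ j → F.zero ≢ f j
    fj≢0 j 0≡fj = f0≢0 (increasing⇒zero-first (proj₁ occ) j (sym 0≡fj))
    f′ : Fin (suc k) → Fin n
    f′ j = punchOut (fj≢0 j)
    suc∘f′ : ∀ j → F.suc (f′ j) ≡ f j
    suc∘f′ j = F.punchIn-punchOut (fj≢0 j)

prepend-injective : ∀ {n r} → Injective _≡_ _≡_ (uncurry (prepend {n} {r}))
prepend-injective {n} {r} {x = (v , c) , w} {(v′ , c′) , w′} eq with refl ← proj₁ (∷-injective eq) =
  cong ((v , c) ,_) (map-injective shift-inj (proj₂ (∷-injective eq)))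
  where
  shift-inj : Injective _≡_ _≡_ (Product.map₁ {C = Fin r} (punchIn v))
  shift-inj eq′ = cong₂ _,_ (F.punchIn-injective v _ _ (cong proj₁ eq′)) (cong proj₂ eq′)

prepend-surjective : ∀ {n r} (ψ : Word (suc n) r) → IsPerm ψ → ∃₂ λ e w → prepend e w ≡ ψ
prepend-surjective {n} {r} ((v , c) ∷ ψ′) ψ-perm = (v , c) , w , cong ((v , c) ∷_) map-w≡ψ′
  where
  v≢ : ∀ i → v ≢ proj₁ (lookup ψ′ i)
  v≢ i = F.0≢1+n ∘ ψ-perm F.zero (F.suc i)
  w : Word n r
  w = tabulate (λ i → punchOut (v≢ i) , proj₂ (lookup ψ′ i))
  map-w≡ψ′ : Vec.map (Product.map₁ (punchIn v)) w ≡ ψ′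
  map-w≡ψ′ = trans (sym (tabulate-∘ _ _))
    (trans (tabulate-cong (λ i → cong (_, _) (F.punchIn-punchOut (v≢ i)))) (tabulate∘lookup ψ′))

-- The occurrence formed by a window of consecutive values

module Window {N r} (ψ : Word N r) (s k : ℕ) where

  InWindow : Fin N → Set
  InWindow i = s ≤ toℕ (symb ψ i) × toℕ (symb ψ i) < s + k

  record WindowPattern : Set where
    field
      standardisation      : Word k r
      standardisation-perm : IsPerm standardisation
      positions            : Fin k → Fin N
      occurrence           : Occurrence ψ standardisation positions
      shifted              : ∀ j → toℕ (symb standardisation j) + s ≡ toℕ (symb ψ (positions j))
      complete             : ∀ i → InWindow i → ∃ λ j → positions j ≡ i

  private
    offset< : ∀ {i} → InWindow i → toℕ (symb ψ i) ∸ s < k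
    offset< (s≤ψi , ψi<s+k) = subst (_ <_) (m+n∸m≡n s k) (∸-monoˡ-< ψi<s+k s≤ψi)

    fromEnumeration : ∀ {K} → IsPerm ψ → (e : Fin K → Fin N) → StrictlyIncreasing e →
                      (∀ j → InWindow (e j)) → (∀ i → InWindow i → ∃ λ j → e j ≡ i) → K ≡ k →
                      WindowPattern
    fromEnumeration ψ-perm e e-inc e-sound e-complete refl = record
      { standardisation      = φ
      ; standardisation-perm = φ-perm
      ; positions            = e
      ; occurrence           = e-inc , order , (λ j → sym (cong proj₂ (lookup∘tabulate _ j)))
      ; shifted              = shifted
      ; complete             = e-complete
      }
      where
      φ : Word k r
      φ = tabulate (λ j → fromℕ< (offset< (e-sound j)) , col ψ (e j))
      shifted : ∀ j → toℕ (symb φ j) + s ≡ toℕ (symb ψ (e j))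
      shifted j = begin
        toℕ (symb φ j) + s                      ≡⟨ cong ((_+ s) ∘ toℕ ∘ proj₁) (lookup∘tabulate _ j) ⟩
        toℕ (fromℕ< (offset< (e-sound j))) + s  ≡⟨ cong (_+ s) (F.toℕ-fromℕ< _) ⟩
        toℕ (symb ψ (e j)) ∸ s + s              ≡⟨ m∸n+n≡m (proj₁ (e-sound j)) ⟩
        toℕ (symb ψ (e j))                      ∎
        where open ≡-Reasoning
      φ-perm : IsPerm φ
      φ-perm i j φi≡φj = increasing⇒injective e-inc (ψ-perm _ _ (F.toℕ-injective
        (trans (sym (shifted i)) (trans (cong (λ x → toℕ x + s) φi≡φj) (shifted j)))))
      order : ∀ j j' → (symb ψ (e j) F.< symb ψ (e j')) ⇔ (symb φ j F.< symb φ j')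
      order j j' = mk⇔ (λ lt → +-cancelʳ-< s _ _ (subst₂ _<_ (sym (shifted j)) (sym (shifted j')) lt))
                       (λ lt → subst₂ _<_ (shifted j) (shifted j') (+-monoˡ-< s lt))

  windowPattern : IsPerm ψ → s + k ≤ N → WindowPattern
  windowPattern ψ-perm s+k≤N = fromEnumeration ψ-perm at increasing sound complete size≡k
    where
    open IncreasingEnumeration (enumerate (λ i → s ≤? toℕ (symb ψ i) ×-dec toℕ (symb ψ i) <? s + k))
    offset : Fin size → Fin k
    offset j = fromℕ< (offset< (sound j))
    offset-inj : Injective _≡_ _≡_ offset
    offset-inj {i} {j} eq = increasing⇒injective increasing (ψ-perm _ _ (F.toℕ-injective
      (∸-cancelʳ-≡ (proj₁ (sound i)) (proj₁ (sound j))
        (trans (sym (F.toℕ-fromℕ< _)) (trans (cong toℕ eq) (F.toℕ-fromℕ< _))))))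
    s+u<N : ∀ (u : Fin k) → s + toℕ u < N
    s+u<N u = <-≤-trans (+-monoʳ-< s (F.toℕ<n u)) s+k≤N
    position : ∀ (u : Fin k) → ∃ λ i → symb ψ i ≡ fromℕ< (s+u<N u)
    position u = injective⇒surjective (ψ-perm _ _) (fromℕ< (s+u<N u))
    value : ∀ u → toℕ (symb ψ (proj₁ (position u))) ≡ s + toℕ u
    value u = trans (cong toℕ (proj₂ (position u))) (F.toℕ-fromℕ< (s+u<N u))
    position-inWindow : ∀ u → InWindow (proj₁ (position u))
    position-inWindow u = subst (s ≤_) (sym (value u)) (m≤m+n s _) ,
                          subst (_< s + k) (sym (value u)) (+-monoʳ-< s (F.toℕ<n u))
    index : Fin k → Fin size
    index u = proj₁ (complete _ (position-inWindow u))
    at∘index : ∀ u → at (index u) ≡ proj₁ (position u)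
    at∘index u = proj₂ (complete _ (position-inWindow u))
    index-inj : Injective _≡_ _≡_ index
    index-inj {u} {u′} eq = F.toℕ-injective (+-cancelˡ-≡ s _ _ (begin
      s + toℕ u                           ≡⟨ sym (value u) ⟩
      toℕ (symb ψ (proj₁ (position u)))   ≡⟨ cong (toℕ ∘ symb ψ) (trans (sym (at∘index u))
                                                                    (trans (cong at eq) (at∘index u′))) ⟩
      toℕ (symb ψ (proj₁ (position u′)))  ≡⟨ value u′ ⟩
      s + toℕ u′                          ∎))
      where open ≡-Reasoning
    size≡k : size ≡ k
    size≡k = F.cantor-schröder-bernstein offset-inj index-inj

-- Counting avoiders

prodLen-suc : ∀ m t (f : ℕ → ℕ) → prodLen m (suc t) f ≡ prodLen m t f * f (t + m)
prodLen-suc m zero    f = trans (*-identityʳ (f m)) (sym (+-identityʳ (f m)))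
prodLen-suc m (suc t) f = begin
  f m * prodLen (suc m) (suc t) f           ≡⟨ cong (f m *_) (prodLen-suc (suc m) t f) ⟩
  f m * (prodLen (suc m) t f * f (t + suc m)) ≡⟨ sym (*-assoc (f m) _ _) ⟩
  f m * prodLen (suc m) t f * f (t + suc m)   ≡⟨ cong (f m * prodLen (suc m) t f *_) (cong f (+-suc t m)) ⟩
  f m * prodLen (suc m) t f * f (suc t + m)   ∎
  where open ≡-Reasoning

room⇒+≤ : ∀ {p k V n} → p < k → V ≤ n → k ∸ suc p ≤ n ∸ V → V + k ≤ n + suc p
room⇒+≤ {p} {k} {V} {n} p<k V≤n room = begin
  V + k                    ≡⟨ cong (V +_) (sym (m∸n+n≡m p<k)) ⟩
  V + (k ∸ suc p + suc p)  ≡⟨ sym (+-assoc V _ _) ⟩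
  V + (k ∸ suc p) + suc p  ≤⟨ +-monoˡ-≤ (suc p) (+-monoʳ-≤ V room) ⟩
  V + (n ∸ V) + suc p      ≡⟨ cong (_+ suc p) (m+[n∸m]≡n V≤n) ⟩
  n + suc p                ∎
  where open ≤-Reasoning

module Avoidance {r} (I : Subset r) {k′ a b : ℕ} (1≤a : 1 ≤ a) (a≤b : a ≤ b) (b≤k : b ≤ suc k′) where

  k : ℕ
  k = suc k′

  Avoids : ∀ {n} → Word n r → Set
  Avoids = InAvoidSet k a b I

  -- V is the value of the first entry of a word of length suc n, counted from 0.
  Critical : ℕ → ℕ → Set
  Critical n V = a ≤ suc V × V + k ≤ n + b × k ≤ suc n

  fitting⇒critical : ∀ {n V m} → a ≤ m → m ≤ b → m ≤ suc V → V + k ≤ n + m → Critical n V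
  fitting⇒critical {n} {V} {m} a≤m m≤b m≤1+V V+k≤n+m =
    ≤-trans a≤m m≤1+V , ≤-trans V+k≤n+m (+-monoʳ-≤ n m≤b) , +-cancelˡ-≤ V k (suc n) V+k≤V+1+n
    where
    V+k≤V+1+n : V + k ≤ V + suc n
    V+k≤V+1+n = begin
      V + k      ≤⟨ V+k≤n+m ⟩
      n + m      ≤⟨ +-monoʳ-≤ n m≤1+V ⟩
      n + suc V  ≡⟨ +-comm n (suc V) ⟩
      suc V + n  ≡⟨ sym (+-suc V n) ⟩
      V + suc n  ∎
      where open ≤-Reasoning

  -- m is the first symbol of a pattern to be matched: it needs m − 1 values below V and
  -- k − m values above V among the n remaining entries.
  critical⇒fitting : ∀ {n V} → Critical n V → ∃ λ m → a ≤ m × m ≤ b × m ≤ suc V × V + k ≤ n + m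
  critical⇒fitting {n} {V} (a≤1+V , V+k≤n+b , k≤1+n) =
    a ⊔ (V + k ∸ n) ,
    m≤m⊔n a _ ,
    ⊔-lub a≤b (m≤n+o⇒m∸n≤o (V + k) n V+k≤n+b) ,
    ⊔-lub a≤1+V (m≤n+o⇒m∸n≤o (V + k) n V+k≤n+1+V) ,
    ≤-trans (m≤n+m∸n (V + k) n) (+-monoʳ-≤ n (m≤n⊔m a _))
    where
    V+k≤n+1+V : V + k ≤ n + suc V
    V+k≤n+1+V = ≤-trans (+-monoʳ-≤ V k≤1+n) (≤-reflexive (trans (+-comm V (suc n)) (sym (+-suc n V))))

  occurrence-at-first⇒critical : ∀ {n} {ψ : Word (suc n) r} {φ : Word k r} → InUnionT a b I φ →
    ((f , _) : Contains ψ φ) → f F.zero ≡ F.zero →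
    col ψ F.zero ∈ I × Critical n (toℕ (symb ψ F.zero))
  occurrence-at-first⇒critical {n} {ψ} {φ} (m , a≤m , m≤b , φ-perm , first) (f , occ) f0≡0
    with g , g-inc , g∘symb ← occurrence⇒valueMap {ψ = ψ} {φ} φ-perm occ =
    subst (_∈ I) (trans (sym (proj₂ (proj₂ occ) F.zero)) (cong (col ψ) f0≡0))
                 (proj₂ (first F.zero refl)) ,
    fitting⇒critical a≤m m≤b m≤1+V (subst (λ x → V + k ≤ n + x) 1+p≡m
      (room⇒+≤ (F.toℕ<n (symb φ F.zero)) (s≤s⁻¹ (F.toℕ<n (symb ψ F.zero))) room))
    where
    p V : ℕ
    p = toℕ (symb φ F.zero)
    V = toℕ (symb ψ F.zero)
    gp≡V : toℕ (g (symb φ F.zero)) ≡ V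
    gp≡V = cong toℕ (trans (g∘symb F.zero) (cong (symb ψ) f0≡0))
    room : k ∸ suc p ≤ n ∸ V
    room = subst (λ x → k ∸ suc p ≤ n ∸ x) gp≡V (increasing⇒room-above g-inc (symb φ F.zero))
    1+p≡m : suc p ≡ m
    1+p≡m = trans (+-comm 1 p) (proj₁ (first F.zero refl))
    m≤1+V : m ≤ suc V
    m≤1+V = subst (_≤ suc V) 1+p≡m
      (s≤s (subst (p ≤_) gp≡V (increasing⇒toℕ≤ g-inc (symb φ F.zero))))

  -- The entries with values in [s, s + k) form an occurrence in which V has offset m − 1.
  critical⇒occurrence-at-first : ∀ {n} (ψ : Word (suc n) r) → IsPerm ψ → col ψ F.zero ∈ I →
    Critical n (toℕ (symb ψ F.zero)) → ∃ λ φ → InUnionT a b I φ × Contains ψ φ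
  critical⇒occurrence-at-first {n} ψ ψ-perm c∈I crit
    with m , a≤m , m≤b , m≤1+V , V+k≤n+m ← critical⇒fitting crit =
    standardisation , (m , a≤m , m≤b , standardisation-perm , first) , positions , occurrence
    where
    V s : ℕ
    V = toℕ (symb ψ F.zero)
    s = suc V ∸ m
    s+m≡1+V : s + m ≡ suc V
    s+m≡1+V = m∸n+n≡m m≤1+V
    s≤V : s ≤ V
    s≤V = s≤s⁻¹ (subst (suc s ≤_) s+m≡1+V
      (≤-trans (≤-reflexive (+-comm 1 s)) (+-monoʳ-≤ s (≤-trans 1≤a a≤m))))
    V<s+k : V < s + k
    V<s+k = subst (_≤ s + k) s+m≡1+V (+-monoʳ-≤ s (≤-trans m≤b b≤k))
    s+k≤1+n : s + k ≤ suc n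
    s+k≤1+n = +-cancelʳ-≤ m (s + k) (suc n) (begin
      s + k + m  ≡⟨ trans (+-assoc s k m) (trans (cong (s +_) (+-comm k m)) (sym (+-assoc s m k))) ⟩
      s + m + k  ≡⟨ cong (_+ k) s+m≡1+V ⟩
      suc V + k  ≤⟨ s≤s V+k≤n+m ⟩
      suc n + m  ∎)
      where open ≤-Reasoning
    open Window.WindowPattern (Window.windowPattern ψ s k ψ-perm s+k≤1+n)
    positions0≡0 : positions F.zero ≡ F.zero
    positions0≡0 = uncurry (increasing⇒zero-first (proj₁ occurrence)) (complete F.zero (s≤V , V<s+k))
    first : ∀ j → toℕ j ≡ 0 → (toℕ (symb standardisation j) + 1 ≡ m) × (col standardisation j ∈ I)
    first F.zero _ =
      +-cancelʳ-≡ s _ m (begin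
        toℕ (symb standardisation F.zero) + 1 + s   ≡⟨ trans (+-assoc _ 1 s) (+-suc _ s) ⟩
        suc (toℕ (symb standardisation F.zero) + s) ≡⟨ cong suc (shifted F.zero) ⟩
        suc (toℕ (symb ψ (positions F.zero)))       ≡⟨ cong (suc ∘ toℕ ∘ symb ψ) positions0≡0 ⟩
        suc V                                       ≡⟨ sym s+m≡1+V ⟩
        s + m                                       ≡⟨ +-comm s m ⟩
        m + s                                       ∎) ,
      subst (_∈ I) (trans (cong (col ψ) (sym positions0≡0)) (proj₂ (proj₂ occurrence) F.zero)) c∈I
      where open ≡-Reasoning

  Good : ∀ n → Fin (suc n) → Set
  Good n v = ¬ Critical n (toℕ v)

  HasCard-good-short : ∀ {n} → suc n < k → HasCard (Good n) (suc n)
  HasCard-good-short {n} 1+n<k =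
    HasCard-⇔ (λ _ → mk⇔ (λ _ (_ , _ , k≤1+n) → <⇒≱ 1+n<k k≤1+n) _) (HasCard-Fin (suc n))

  outside-window⇔¬critical : ∀ {n} → k ≤ suc n → ∀ V →
                             (V < a ∸ 1 ⊎ n + b ∸ k < V) ⇔ (¬ Critical n V)
  outside-window⇔¬critical {n} k≤1+n V = mk⇔
    [ (λ V<a-1 (a≤1+V , _) → <⇒≱ V<a-1 (∸-monoˡ-≤ 1 a≤1+V))
    , (λ B<V (_ , V+k≤n+b , _) → <⇒≱ B<V (m+n≤o⇒m≤o∸n V V+k≤n+b)) ]
    ¬critical⇒outside
    where
    k≤n+b : k ≤ n + b
    k≤n+b = ≤-trans k≤1+n (≤-trans (≤-reflexive (+-comm 1 n)) (+-monoʳ-≤ n (≤-trans 1≤a a≤b)))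
    ¬critical⇒outside : ¬ Critical n V → V < a ∸ 1 ⊎ n + b ∸ k < V
    ¬critical⇒outside ¬crit with V <? a ∸ 1 | n + b ∸ k <? V
    ... | yes V<a-1 | _      = inj₁ V<a-1
    ... | no  _     | yes B<V = inj₂ B<V
    ... | no  V≮a-1 | no  V≯B = contradiction
      ( ≤-trans (m≤n+m∸n a 1) (s≤s (≮⇒≥ V≮a-1))
      , ≤-trans (+-monoˡ-≤ k (≮⇒≥ V≯B)) (≤-reflexive (m∸n+n≡m k≤n+b))
      , k≤1+n ) ¬crit

  module _ {n} (k≤1+n : k ≤ suc n) where

    private
      1≤b : 1 ≤ b
      1≤b = ≤-trans 1≤a a≤b
      x : ℕ
      x = k ∸ b
      x≤n : x ≤ n
      x≤n = ≤-trans (∸-monoʳ-≤ k 1≤b) (∸-monoˡ-≤ 1 k≤1+n)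
      n+b∸k≡n∸x : n + b ∸ k ≡ n ∸ x
      n+b∸k≡n∸x = begin
        n + b ∸ k        ≡⟨ cong (n + b ∸_) (sym (m∸n+n≡m b≤k)) ⟩
        n + b ∸ (x + b)  ≡⟨ cong₂ _∸_ (+-comm n b) (+-comm x b) ⟩
        b + n ∸ (b + x)  ≡⟨ [m+n]∸[m+o]≡n∸o b n x ⟩
        n ∸ x            ∎
        where open ≡-Reasoning

    a∸1≤n+b∸k : a ∸ 1 ≤ n + b ∸ k
    a∸1≤n+b∸k = subst (a ∸ 1 ≤_) (sym n+b∸k≡n∸x) (m+n≤o⇒m≤o∸n (a ∸ 1) (begin
      a ∸ 1 + x        ≤⟨ +-monoˡ-≤ x (∸-monoˡ-≤ 1 a≤b) ⟩
      b ∸ 1 + (k ∸ b)  ≡⟨ +-comm (b ∸ 1) x ⟩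
      k ∸ b + (b ∸ 1)  ≡⟨ sym (+-∸-assoc x 1≤b) ⟩
      k ∸ b + b ∸ 1    ≡⟨ cong (_∸ 1) (m∸n+n≡m b≤k) ⟩
      k ∸ 1            ≤⟨ ∸-monoˡ-≤ 1 k≤1+n ⟩
      n                ∎))
      where open ≤-Reasoning

    a∸1+[n∸[n+b∸k]]≡k+a∸b∸1 : a ∸ 1 + (n ∸ (n + b ∸ k)) ≡ k + a ∸ b ∸ 1
    a∸1+[n∸[n+b∸k]]≡k+a∸b∸1 = begin
      a ∸ 1 + (n ∸ (n + b ∸ k))  ≡⟨ cong (λ y → a ∸ 1 + (n ∸ y)) n+b∸k≡n∸x ⟩
      a ∸ 1 + (n ∸ (n ∸ x))      ≡⟨ cong (a ∸ 1 +_) (m∸[m∸n]≡n x≤n) ⟩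
      a ∸ 1 + x                  ≡⟨ +-comm (a ∸ 1) x ⟩
      x + (a ∸ 1)                ≡⟨ sym (+-∸-assoc x 1≤a) ⟩
      x + a ∸ 1                  ≡⟨ cong (_∸ 1) (sym (+-∸-comm a b≤k)) ⟩
      k + a ∸ b ∸ 1              ∎
      where open ≡-Reasoning

    HasCard-good-long : HasCard (Good n) (k + a ∸ b ∸ 1)
    HasCard-good-long = subst (HasCard (Good n)) a∸1+[n∸[n+b∸k]]≡k+a∸b∸1
      (HasCard-⇔ (λ v → outside-window⇔¬critical k≤1+n (toℕ v))
        (HasCard-⊎ (λ _ V<a∸1 n+b∸k<V → <-asym V<a∸1 (≤-<-trans a∸1≤n+b∸k n+b∸k<V))
          (HasCard-toℕ< (≤-trans (m∸n≤m a 1) (≤-trans a≤b (≤-trans b≤k k≤1+n))))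
          (HasCard-<toℕ (n + b ∸ k))))

  Admissible : ∀ n → Fin (suc n) × Fin r → Set
  Admissible n (v , c) = c ∈ I → Good n v

  HasCard-admissible : ∀ {n g} → HasCard (Good n) g →
                       HasCard (Admissible n) (∣ I ∣ * g + suc n * (r ∸ ∣ I ∣))
  HasCard-admissible {n} {g} good =
    subst (HasCard (Admissible n)) (cong (_+ suc n * (r ∸ ∣ I ∣)) (*-comm g ∣ I ∣))
    (HasCard-⇔ split⇔ (HasCard-⊎ (λ _ (_ , c∈I) (_ , c∉I) → c∉I c∈I)
      (HasCard-× good (HasCard-∈ I)) (HasCard-× (HasCard-Fin (suc n)) (HasCard-∉ I))))
    where
    split⇔ : ∀ e → ((Good n (proj₁ e) × proj₂ e ∈ I) ⊎ (⊤ × proj₂ e ∉ I)) ⇔ Admissible n e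
    split⇔ (v , c) =
      mk⇔ [ (λ (good-v , _) _ → good-v) , (λ (_ , c∉I) c∈I → contradiction c∈I c∉I) ] split
      where
      split : Admissible n (v , c) → _
      split adm with c ∈? I
      ... | yes c∈I = inj₁ (adm c∈I , c∈I)
      ... | no  c∉I = inj₂ (tt , c∉I)

  avoids-prepend⇔ : ∀ {n} {e : Fin (suc n) × Fin r} {w : Word n r} →
                    Avoids (prepend e w) ⇔ (Admissible n e × Avoids w)
  avoids-prepend⇔ {n} {v , c} {w} = mk⇔
    (λ ψ-avoids@(ψ-perm , ψ-avoid) →
      admissible ψ-avoids , to isPerm-prepend⇔ ψ-perm ,
      (λ φ φ∈T → ψ-avoid φ φ∈T ∘ contains-prepend {φ = φ}))
    (λ (adm , w-avoids@(w-perm , _)) → from isPerm-prepend⇔ w-perm , no-occurrence adm w-avoids)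
    where
    ψ : Word (suc n) r
    ψ = prepend (v , c) w
    admissible : Avoids ψ → Admissible n (v , c)
    admissible (ψ-perm , ψ-avoid) c∈I crit =
      let φ , φ∈T , ψ⊇φ = critical⇒occurrence-at-first {n} ψ ψ-perm c∈I crit in ψ-avoid φ φ∈T ψ⊇φ
    no-occurrence : Admissible n (v , c) → Avoids w → ∀ φ → InUnionT a b I φ → ¬ Contains ψ φ
    no-occurrence adm (_ , w-avoid) φ φ∈T ψ⊇φ@(f , _) with f F.zero F.≟ F.zero
    ... | yes f0≡0 = uncurry adm (occurrence-at-first⇒critical {ψ = ψ} {φ} φ∈T ψ⊇φ f0≡0)
    ... | no  f0≢0 = w-avoid φ φ∈T (contains-prepend⁻ {φ = φ} ψ⊇φ f0≢0)

  HasCard-avoids-[] : HasCard (Avoids {0}) 1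
  HasCard-avoids-[] = HasCard-⇔
    (λ { [] → mk⇔ (λ _ → (λ ()) , (λ _ _ (f , _) → contradiction (f F.zero) λ ())) (λ _ → refl) })
    (HasCard-≡ [])

  HasCard-avoids-suc : ∀ {n p q} → HasCard (Admissible n) p → HasCard (Avoids {n}) q →
                       HasCard (Avoids {suc n}) (p * q)
  HasCard-avoids-suc {n} admissible avoids =
    HasCard-⇔ image⇔ (HasCard-image (uncurry prepend) prepend-injective (HasCard-× admissible avoids))
    where
    image⇔ : ∀ ψ → (∃ λ ew → (Admissible n (proj₁ ew) × Avoids (proj₂ ew)) × uncurry prepend ew ≡ ψ)
                 ⇔ Avoids ψ
    image⇔ ψ = mk⇔
      (λ { (_ , adm-avoids , refl) → from avoids-prepend⇔ adm-avoids })
      (λ ψ-avoids → let e , w , eq = prepend-surjective ψ (proj₁ ψ-avoids) in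
        (e , w) , to avoids-prepend⇔ (subst Avoids (sym eq) ψ-avoids) , eq)

  factor : ℕ → ℕ
  factor j = ∣ I ∣ * (k + a ∸ b ∸ 1) + j * (r ∸ ∣ I ∣)

  HasCard-avoids-short : ∀ n → n < k → HasCard (Avoids {n}) (n ! * r ^ n)
  HasCard-avoids-short zero    _     = HasCard-avoids-[]
  HasCard-avoids-short (suc n) 1+n<k = subst (HasCard Avoids) count≡
    (HasCard-avoids-suc (HasCard-admissible (HasCard-good-short 1+n<k))
                        (HasCard-avoids-short n (<-trans (n<1+n n) 1+n<k)))
    where
    d : ℕ
    d = ∣ I ∣
    admissible≡ : d * suc n + suc n * (r ∸ d) ≡ suc n * r
    admissible≡ = begin
      d * suc n + suc n * (r ∸ d)  ≡⟨ cong (_+ suc n * (r ∸ d)) (*-comm d (suc n)) ⟩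
      suc n * d + suc n * (r ∸ d)  ≡⟨ sym (*-distribˡ-+ (suc n) d (r ∸ d)) ⟩
      suc n * (d + (r ∸ d))        ≡⟨ cong (suc n *_) (m+[n∸m]≡n (∣p∣≤n I)) ⟩
      suc n * r                    ∎
      where open ≡-Reasoning
    count≡ : (d * suc n + suc n * (r ∸ d)) * (n ! * r ^ n) ≡ suc n ! * r ^ suc n
    count≡ = trans (cong (_* (n ! * r ^ n)) admissible≡)
      (solve 4 (λ x y z w → (x :* y) :* (z :* w) := (x :* z) :* (y :* w)) refl (suc n) r (n !) (r ^ n))

  HasCard-avoids-long : ∀ t → HasCard (Avoids {t + k′}) (k′ ! * r ^ k′ * prodLen k t factor)
  HasCard-avoids-long zero    =
    subst (HasCard Avoids) (sym (*-identityʳ _)) (HasCard-avoids-short k′ (n<1+n k′))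
  HasCard-avoids-long (suc t) = subst (HasCard Avoids) count≡
    (HasCard-avoids-suc (HasCard-admissible (HasCard-good-long {t + k′} (s≤s (m≤n+m k′ t))))
                        (HasCard-avoids-long t))
    where
    C P : ℕ
    C = k′ ! * r ^ k′
    P = prodLen k t factor
    count≡ : factor (suc (t + k′)) * (C * P) ≡ C * prodLen k (suc t) factor
    count≡ = begin
      factor (suc (t + k′)) * (C * P)  ≡⟨ *-comm (factor (suc (t + k′))) (C * P) ⟩
      C * P * factor (suc (t + k′))    ≡⟨ *-assoc C P (factor (suc (t + k′))) ⟩
      C * (P * factor (suc (t + k′)))  ≡⟨ cong (λ x → C * (P * factor x)) (sym (+-suc t k′)) ⟩
      C * (P * factor (t + k))         ≡⟨ cong (C *_) (sym (prodLen-suc k t factor)) ⟩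
      C * prodLen k (suc t) factor     ∎
      where open ≡-Reasoning

corollary1 : (k r a b n : ℕ) → 1 ≤ k → 1 ≤ r → 1 ≤ a → a ≤ b → b ≤ k → k ≤ n →
    (I : Subset r) →
    HasCard (InAvoidSet {n} {r} k a b I)
      ((k ∸ 1) ! * r ^ (k ∸ 1) *
        prodFromTo k n (λ j → ∣ I ∣ * (k + a ∸ b ∸ 1) + j * (r ∸ ∣ I ∣)))
corollary1 (suc k′) r a b n _ _ 1≤a a≤b b≤k k≤n I =
  subst (λ m → HasCard (Avoids {m}) (k′ ! * r ^ k′ * prodLen k (n ∸ k′) factor))
        (m∸n+n≡m (≤-trans (n≤1+n k′) k≤n)) (HasCard-avoids-long (n ∸ k′))
  where open Avoidance I 1≤a a≤b b≤k
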